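{- With $W(N,k)=\sum_{k\text{ -winnable }\pi\in\mathfrak{S}_N}\theta^{\mathrm{inv}(\pi)}$, for $N\ge1$ and $1\le k\le N-1$, $$W(N,k)=\theta^{N-k-1}[N-1]_\theta!\sum_{i=k}^{N-1}\frac{[k]_\theta}{[i]_\theta},$$ and $W(N,0)=\theta^{N-1}[N-1]_\theta!$.
   Context: $\theta>0$. $\mathrm{inv}(\pi)$ is the number of inversions of $\pi$ (pairs $i<j$ with $\pi_i>\pi_j$). $[n]_\theta=1+\theta+\cdots+\theta^{n-1}$, $[n]_\theta!=[n]_\theta\cdots[1]_\theta$, $[0]_\theta!=1$. A permutation $\pi\in\mathfrak{S}_N$ is $k$-winnable if the strategy that rejects the first $k$ entries and then accepts the first subsequent entry larger than all previous entries selects the entry $N$.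
   Formalization: The parameter θ ranges over the positive rationals instead of the positive reals. -}

module Defs where

open import Data.Nat as ℕ using (ℕ; zero; suc; _∸_; _⊔_; _<ᵇ_; _≡ᵇ_)
open import Data.Bool using (Bool; true; false; if_then_else_; _∧_; not)
open import Data.List using (List; []; _∷_; map; concatMap; filter; upTo)
open import Data.Bool.ListAction using (any)
open import Data.Nat.ListAction using (sum)
open import Data.Maybe using (Maybe; just; nothing)
open import Data.Rational using (ℚ; 0ℚ; 1ℚ; _+_; _*_; _÷_; ≢-nonZero)
open import Data.Rational.Properties using (_≟_)
open import Relation.Nullary using (yes; no)

-- Permutations of [N] = {1,…,N} in one-line notation π = π₁ π₂ … π_N,
-- i.e. lists of length N with entries in {1,…,N} and no repetitions.

seqs : ℕ → ℕ → List (List ℕ)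
seqs N zero    = [] ∷ []
seqs N (suc l) = concatMap (λ x → map (x ∷_) (seqs N l)) (map suc (upTo N))

distinctᵇ : List ℕ → Bool
distinctᵇ []       = true
distinctᵇ (x ∷ xs) = not (any (λ y → x ≡ᵇ y) xs) ∧ distinctᵇ xs

perms : ℕ → List (List ℕ)
perms N = filter (λ π → distinctᵇ π Data.Bool.≟ true) (seqs N N)

inv : List ℕ → ℕ
inv []       = 0
inv (x ∷ xs) = sum (map (λ y → if y <ᵇ x then 1 else 0) xs) ℕ.+ inv xs

-- The strategy: reject the first k entries, then accept the first
-- subsequent entry larger than all previous entries.
-- select k m π : entry selected, where m is the maximum of the entries
-- seen so far (0 if none; entries are ≥ 1).

select : ℕ → ℕ → List ℕ → Maybe ℕ
select k       m []       = nothing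
select zero    m (x ∷ xs) = if m <ᵇ x then just x else select zero (m ⊔ x) xs
select (suc k) m (x ∷ xs) = select k (m ⊔ x) xs

winnableᵇ : ℕ → ℕ → List ℕ → Bool
winnableᵇ N k π with select k 0 π
... | just x  = x ≡ᵇ N
... | nothing = false

_^_ : ℚ → ℕ → ℚ
θ ^ zero  = 1ℚ
θ ^ suc n = θ * (θ ^ n)

sumℚ : List ℚ → ℚ
sumℚ []       = 0ℚ
sumℚ (x ∷ xs) = x + sumℚ xs

-- total division (p / 0 := 0); only ever applied to nonzero divisors here
_/_ : ℚ → ℚ → ℚ
p / q with q ≟ 0ℚ
... | yes _  = 0ℚ
... | no q≢0 = _÷_ p q {{≢-nonZero q≢0}}

[_]_ : ℕ → ℚ → ℚ
[ n ] θ = sumℚ (map (θ ^_) (upTo n))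

[_]!_ : ℕ → ℚ → ℚ
[ zero ]! θ  = 1ℚ
[ suc n ]! θ = ([ suc n ] θ) * ([ n ]! θ)

W : ℚ → ℕ → ℕ → ℚ
W θ N k = sumℚ (map (λ π → θ ^ inv π)
                    (filter (λ π → winnableᵇ N k π Data.Bool.≟ true) (perms N)))

rhsSum : ℚ → ℕ → ℕ → ℚ
rhsSum θ N k = sumℚ (map (λ i → ([ k ] θ) / ([ i ] θ)) (map (k ℕ.+_) (upTo (N ∸ k))))

{-# OPTIONS --safe #-}
-- Shifting σ ∈ 𝔖ₙ up by one and inserting a new smallest entry 1 at position p ∈ {0,…,n} is a
-- bijection 𝔖ₙ × {0,…,n} → 𝔖ₙ₊₁ which adds exactly p inversions.  The 1 is never a new maximum
-- once another entry has been seen, so for k ≥ 1 it only matters whether it falls among the k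
-- rejected entries (then σ is played with k − 1 rejections) or not (then with k).  Summing the
-- geometric weights θ^p over the two ranges of positions gives
--   W(n+1, j+1) = [j+1] W(n, j) + θ^(j+1) [n−j] W(n, j+1),   W(n+2, 0) = θ [n+1] W(n+1, 0),
-- and induction on (k, d) yields W(k+d+1, k) = θ^d [k+d]! (1 + [k] (H(k+d) − H(k))) with the
-- q-harmonic numbers H(m) = Σ_{i=1}^m 1/[i].  For θ > 0 every [i] with i ≥ 1 is positive, and
-- 1 + [k] (H(N−1) − H(k)) is the paper's [k] Σ_{i=k}^{N−1} 1/[i] with the term i = k split off.
module Submission where

open import Defs
open import Data.Nat using (ℕ; _≤_; _∸_)
open import Data.Rational using (ℚ; 0ℚ; _<_; _*_)
open import Data.Product using (_×_)
open import Relation.Binary.PropositionalEquality using (_≡_)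

open import Data.Bool using (Bool; true; false; if_then_else_; T; not)
import Data.Bool as Bool
open import Data.Bool.ListAction using (any)
open import Data.Bool.Properties using (T-∧; T-≡)
open import Data.Empty using (⊥-elim)
open import Data.List
  using (List; []; _∷_; _++_; _∷ʳ_; map; filter; foldr; length; upTo; applyUpTo; concatMap;
         cartesianProduct; cartesianProductWith)
open import Data.List.Properties
  using (map-∘; map-upTo; upTo-∷ʳ; foldr-universal; filter-none; length-map; length-upTo; length-++;
         ∷-injective; ∷-injectiveˡ; map-injective)
open import Data.List.Membership.Propositional using (_∈_; _∉_)
open import Data.List.Membership.Propositional.Properties
  using (∈-∃++; ∈-++⁻; ∈-++⁺ˡ; ∈-++⁺ʳ; ∈-map⁻; ∈-map⁺; ∈-filter⁻; ∈-filter⁺;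
         ∈-upTo⁻; ∈-upTo⁺;
         ∈-cartesianProduct⁻; ∈-cartesianProduct⁺; ∈-cartesianProductWith⁻; ∈-cartesianProductWith⁺)
open import Data.List.Membership.Propositional.Properties.WithK using (unique∧set⇒bag)
open import Data.List.Relation.Binary.BagAndSetEquality using (∼bag⇒↭)
open import Data.List.Relation.Binary.Subset.Propositional using (_⊆_)
open import Data.List.Relation.Binary.Permutation.Propositional
  using (_↭_; ↭-refl; ↭-prep; ↭-swap; ↭-trans; ↭-sym; ↭⇒↭ₛ; module PermutationReasoning)
open import Data.List.Relation.Binary.Permutation.Propositional.Properties
  using (map⁺; ↭-length; shift; drop-mid; ↭-map-inv; ∈-resp-↭; All-resp-↭)
open import Data.List.Relation.Binary.Permutation.Setoid.Properties using (foldr-commMonoid; Unique-resp-↭)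
open import Data.List.Relation.Unary.All as All using (All; []; _∷_)
import Data.List.Relation.Unary.All.Properties as All
open import Data.List.Relation.Unary.AllPairs using ([]; _∷_)
open import Data.List.Relation.Unary.Any using (here; there)
open import Data.List.Relation.Unary.Unique.Propositional using (Unique)
import Data.List.Relation.Unary.Unique.Propositional.Properties as Unique
open import Data.Maybe using (Maybe; just; nothing)
import Data.Maybe as Maybe
import Data.Nat as ℕ
open import Data.Nat using (zero; suc; z≤n; s≤s; _⊔_; _<ᵇ_; _≡ᵇ_)
open import Data.Nat.ListAction using (sum)
open import Data.Nat.ListAction.Properties using (sum-↭)
open import Data.Nat.Properties
  using (suc-injective; ≡⇒≡ᵇ; ≡ᵇ⇒≡; ≤-pred; ≤-trans; ≤-refl; ≤-reflexive; m≤m+n; +-monoʳ-≤;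
         +-suc; +-identityʳ; +-comm; m+n∸m≡n; m≤n⇒∃[o]m+o≡n; ⊔-identityʳ; +-commutativeSemigroup;
         module ≤-Reasoning)
open import Algebra.Properties.CommutativeSemigroup +-commutativeSemigroup using (x∙yz≈y∙xz)
open import Data.Product using (_,_; uncurry)
open import Data.Rational using (1ℚ; _+_; _-_; ≢-nonZero)
import Data.Rational as ℚ
import Data.Rational.Properties as ℚ
open import Data.Sum using (inj₁; inj₂)
open import Function using (_∘_; mk⇔; Equivalence)
open import Level using (0ℓ)
open import Relation.Binary.PropositionalEquality
  using (_≢_; refl; sym; trans; cong; cong₂; subst; subst₂; setoid; module ≡-Reasoning)
open import Relation.Nullary using (yes; no; contradiction)
open import Tactic.RingSolver using (solve-∀)
open import Tactic.RingSolver.Core.AlmostCommutativeRing using (AlmostCommutativeRing; fromCommutativeRing)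

private variable
  A B C : Set
  xs ys : List A
  f g : A → ℚ

ℚ-ring : AlmostCommutativeRing 0ℓ 0ℓ
ℚ-ring = fromCommutativeRing ℚ.+-*-commutativeRing isZero
  where
  isZero : ∀ q → Maybe (0ℚ ≡ q)
  isZero q with 0ℚ ℚ.≟ q
  ... | yes 0≡q = just 0≡q
  ... | no  _   = nothing

∑ : List A → (A → ℚ) → ℚ
∑ xs f = sumℚ (map f xs)

infixl 10 ∑
syntax ∑ xs (λ x → e) = ∑[ x ∈ xs ] e

sumℚ-↭ : {xs ys : List ℚ} → xs ↭ ys → sumℚ xs ≡ sumℚ ys
sumℚ-↭ {xs} {ys} p = begin
  sumℚ xs          ≡⟨ sumℚ-is-foldr xs ⟩
  foldr _+_ 0ℚ xs  ≡⟨ foldr-commMonoid (setoid ℚ) ℚ.+-0-isCommutativeMonoid (↭⇒↭ₛ p) ⟩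
  foldr _+_ 0ℚ ys  ≡⟨ sumℚ-is-foldr ys ⟨
  sumℚ ys          ∎
  where
  open ≡-Reasoning
  sumℚ-is-foldr : ∀ zs → sumℚ zs ≡ foldr _+_ 0ℚ zs
  sumℚ-is-foldr = foldr-universal sumℚ _+_ 0ℚ refl (λ _ _ → refl)

∑-↭ : xs ↭ ys → ∑ xs f ≡ ∑ ys f
∑-↭ p = sumℚ-↭ (map⁺ _ p)

∑-++ : ∀ xs ys → ∑ (xs ++ ys) f ≡ ∑ xs f + ∑ ys f
∑-++         []       ys = sym (ℚ.+-identityˡ _)
∑-++ {f = f} (x ∷ xs) ys = trans (cong (f x +_) (∑-++ xs ys)) (sym (ℚ.+-assoc (f x) _ _))

∑-map : (h : B → A) (xs : List B) → ∑ (map h xs) f ≡ ∑ xs (f ∘ h)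
∑-map h xs = cong sumℚ (sym (map-∘ xs))

∑-cartesianProduct : (xs : List A) (ys : List B) (f : A × B → ℚ) →
                     ∑ (cartesianProduct xs ys) f ≡ ∑[ x ∈ xs ] ∑[ y ∈ ys ] f (x , y)
∑-cartesianProduct []       ys f = refl
∑-cartesianProduct (x ∷ xs) ys f = begin
  ∑ (map (x ,_) ys ++ cartesianProduct xs ys) f
    ≡⟨ ∑-++ (map (x ,_) ys) _ ⟩
  ∑ (map (x ,_) ys) f + ∑ (cartesianProduct xs ys) f
    ≡⟨ cong₂ _+_ (∑-map (x ,_) ys) (∑-cartesianProduct xs ys f) ⟩
  ∑[ y ∈ ys ] f (x , y) + ∑[ x′ ∈ xs ] ∑[ y ∈ ys ] f (x′ , y) ∎
  where open ≡-Reasoning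

∑-cong : ∀ xs → (∀ {x} → x ∈ xs → f x ≡ g x) → ∑ xs f ≡ ∑ xs g
∑-cong []       f≡g = refl
∑-cong (x ∷ xs) f≡g = cong₂ _+_ (f≡g (here refl)) (∑-cong xs (f≡g ∘ there))

∑-*ˡ : ∀ c xs → ∑[ x ∈ xs ] (c * f x) ≡ c * ∑ xs f
∑-*ˡ         c []       = sym (ℚ.*-zeroʳ c)
∑-*ˡ {f = f} c (x ∷ xs) = trans (cong (c * f x +_) (∑-*ˡ c xs)) (sym (ℚ.*-distribˡ-+ c (f x) _))

∑-*ʳ : ∀ c xs → ∑[ x ∈ xs ] (f x * c) ≡ ∑ xs f * c
∑-*ʳ {f = f} c xs = begin
  ∑[ x ∈ xs ] (f x * c) ≡⟨ ∑-cong xs (λ {x} _ → ℚ.*-comm (f x) c) ⟩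
  ∑[ x ∈ xs ] (c * f x) ≡⟨ ∑-*ˡ c xs ⟩
  c * ∑ xs f            ≡⟨ ℚ.*-comm c _ ⟩
  ∑ xs f * c            ∎
  where open ≡-Reasoning

∑-+ : ∀ xs → ∑[ x ∈ xs ] (f x + g x) ≡ ∑ xs f + ∑ xs g
∑-+                 []       = refl
∑-+ {f = f} {g = g} (x ∷ xs) = trans (cong (f x + g x +_) (∑-+ xs)) (interchange (f x) (g x) _ _)
  where
  interchange : ∀ a b c d → a + b + (c + d) ≡ a + c + (b + d)
  interchange = solve-∀ ℚ-ring

∑-filter : (P : A → Bool) (xs : List A) →
           sumℚ (map f (filter (λ x → P x Bool.≟ true) xs)) ≡ ∑[ x ∈ xs ] (if P x then f x else 0ℚ)
∑-filter         P []       = refl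
∑-filter {f = f} P (x ∷ xs) with P x
... | true  = cong (f x +_) (∑-filter P xs)
... | false = trans (∑-filter P xs) (sym (ℚ.+-identityˡ _))

applyUpTo-+ : (h : ℕ → A) (m n : ℕ) → applyUpTo h (m ℕ.+ n) ≡ applyUpTo h m ++ applyUpTo (h ∘ (m ℕ.+_)) n
applyUpTo-+ h zero    n = refl
applyUpTo-+ h (suc m) n = cong (h 0 ∷_) (applyUpTo-+ (h ∘ suc) m n)

∑-upTo-+ : ∀ (f : ℕ → ℚ) m n →
           ∑[ i ∈ upTo (m ℕ.+ n) ] f i ≡ ∑[ i ∈ upTo m ] f i + ∑[ i ∈ upTo n ] f (m ℕ.+ i)
∑-upTo-+ f m n = begin
  ∑ (upTo (m ℕ.+ n)) f                        ≡⟨ cong (λ is → ∑ is f) (applyUpTo-+ (λ i → i) m n) ⟩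
  ∑ (upTo m ++ applyUpTo (m ℕ.+_) n) f        ≡⟨ ∑-++ (upTo m) _ ⟩
  ∑ (upTo m) f + ∑ (applyUpTo (m ℕ.+_) n) f   ≡⟨ cong (λ is → ∑ (upTo m) f + ∑ is f) (map-upTo (m ℕ.+_) n) ⟨
  ∑ (upTo m) f + ∑ (map (m ℕ.+_) (upTo n)) f  ≡⟨ cong (∑ (upTo m) f +_) (∑-map (m ℕ.+_) (upTo n)) ⟩
  ∑ (upTo m) f + ∑[ i ∈ upTo n ] f (m ℕ.+ i)  ∎
  where open ≡-Reasoning

∑-upTo-suc : ∀ (f : ℕ → ℚ) n → ∑[ i ∈ upTo (suc n) ] f i ≡ ∑[ i ∈ upTo n ] f i + f n
∑-upTo-suc f n = begin
  ∑ (upTo (suc n)) f         ≡⟨ cong (λ is → ∑ is f) (upTo-∷ʳ n) ⟨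
  ∑ (upTo n ∷ʳ n) f          ≡⟨ ∑-++ (upTo n) _ ⟩
  ∑ (upTo n) f + (f n + 0ℚ)  ≡⟨ cong (∑ (upTo n) f +_) (ℚ.+-identityʳ (f n)) ⟩
  ∑ (upTo n) f + f n         ∎
  where open ≡-Reasoning

map-unique : {h : A → B} → (∀ {x y} → x ∈ xs → y ∈ xs → h x ≡ h y → x ≡ y) →
             Unique xs → Unique (map h xs)
map-unique inj []         = []
map-unique inj (x∉ ∷ u) =
  All.map⁺ (All.tabulate (λ y∈xs hx≡hy → All.lookup x∉ y∈xs (inj (here refl) (there y∈xs) hx≡hy)))
  ∷ map-unique (λ x∈ y∈ → inj (there x∈) (there y∈)) u

unique-⊆⇒↭ : Unique xs → xs ⊆ ys → length ys ≤ length xs → xs ↭ ys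
unique-⊆⇒↭ {xs = []} {ys = []}    _ _ _  = ↭-refl
unique-⊆⇒↭ {xs = x ∷ xs} (x∉ ∷ u) xs⊆ys len
  with as , bs , refl ← ∈-∃++ (xs⊆ys (here refl))
  = ↭-trans (↭-prep x (unique-⊆⇒↭ u xs⊆as++bs (≤-pred len′))) (↭-sym (shift x as bs))
  where
  len′ : suc (length (as ++ bs)) ≤ suc (length xs)
  len′ = subst (_≤ suc (length xs)) (↭-length (shift x as bs)) len
  xs⊆as++bs : xs ⊆ as ++ bs
  xs⊆as++bs {z} z∈xs with ∈-++⁻ as (xs⊆ys (there z∈xs))
  ... | inj₁ z∈as          = ∈-++⁺ˡ z∈as
  ... | inj₂ (here refl)   = contradiction refl (All.lookup x∉ z∈xs)
  ... | inj₂ (there z∈bs)  = ∈-++⁺ʳ as z∈bs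

insert : ℕ → A → List A → List A
insert zero    a xs       = a ∷ xs
insert (suc p) a []       = a ∷ []
insert (suc p) a (x ∷ xs) = x ∷ insert p a xs

insert-↭ : ∀ p (a : A) xs → insert p a xs ↭ a ∷ xs
insert-↭ zero    a xs       = ↭-refl
insert-↭ (suc p) a []       = ↭-refl
insert-↭ (suc p) a (x ∷ xs) = ↭-trans (↭-prep x (insert-↭ p a xs)) (↭-swap x a ↭-refl)

insert-++ : ∀ (a : A) xs ys → insert (length xs) a (xs ++ ys) ≡ xs ++ a ∷ ys
insert-++ a []       ys = refl
insert-++ a (x ∷ xs) ys = cong (x ∷_) (insert-++ a xs ys)

insert-injective : ∀ {a : A} p q xs ys → a ∉ xs → a ∉ ys → p ≤ length xs → q ≤ length ys →
                   insert p a xs ≡ insert q a ys → p ≡ q × xs ≡ ys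
insert-injective zero    zero    xs       ys       _    _    _       _       refl = refl , refl
insert-injective zero    (suc q) xs       (y ∷ ys) _    a∉ys _       _       eq   =
  contradiction (here (∷-injectiveˡ eq)) a∉ys
insert-injective (suc p) zero    (x ∷ xs) ys       a∉xs _    _       _       eq   =
  contradiction (here (sym (∷-injectiveˡ eq))) a∉xs
insert-injective (suc p) (suc q) (x ∷ xs) (y ∷ ys) a∉xs a∉ys (s≤s p≤) (s≤s q≤) eq
  with refl , eq′ ← ∷-injective eq
  with refl , refl ← insert-injective p q xs ys (a∉xs ∘ there) (a∉ys ∘ there) p≤ q≤ eq′
  = refl , refl

range : ℕ → List ℕ
range n = map suc (upTo n)

range-suc : ∀ n → range (suc n) ≡ 1 ∷ map suc (range n)
range-suc n = cong (λ is → 1 ∷ map suc is) (sym (map-upTo suc n))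

length-range : ∀ n → length (range n) ≡ n
length-range n = trans (length-map suc (upTo n)) (length-upTo n)

range-unique : ∀ n → Unique (range n)
range-unique n = Unique.map⁺ suc-injective (Unique.upTo⁺ n)

concatMap-map : (h : A → B → C) (xs : List A) (ys : List B) →
                concatMap (λ x → map (h x) ys) xs ≡ cartesianProductWith h xs ys
concatMap-map h []       ys = refl
concatMap-map h (x ∷ xs) ys = cong (map (h x) ys ++_) (concatMap-map h xs ys)

seqs-suc : ∀ N l → seqs N (suc l) ≡ cartesianProductWith _∷_ (range N) (seqs N l)
seqs-suc N l = concatMap-map _∷_ (range N) (seqs N l)

seqs-unique : ∀ N l → Unique (seqs N l)
seqs-unique N zero    = [] ∷ []
seqs-unique N (suc l) = subst Unique (sym (seqs-suc N l))
  (Unique.cartesianProductWith⁺ _∷_ ∷-injective (range-unique N) (seqs-unique N l))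

∈-seqs⁻ : ∀ {N} l {π} → π ∈ seqs N l → length π ≡ l × All (_∈ range N) π
∈-seqs⁻ zero (here refl) = refl , []
∈-seqs⁻ {N} (suc l) π∈
  with x , π′ , x∈ , π′∈ , refl ←
         ∈-cartesianProductWith⁻ _∷_ (range N) (seqs N l) (subst (_ ∈_) (seqs-suc N l) π∈)
  with len , π′⊆ ← ∈-seqs⁻ l π′∈
  = cong suc len , x∈ ∷ π′⊆

∈-seqs⁺ : ∀ {N} l {π} → length π ≡ l → All (_∈ range N) π → π ∈ seqs N l
∈-seqs⁺         zero    {[]}    refl []         = here refl
∈-seqs⁺ {N} (suc l) {x ∷ π} refl (x∈ ∷ π⊆) =
  subst (_ ∈_) (sym (seqs-suc N l)) (∈-cartesianProductWith⁺ _∷_ x∈ (∈-seqs⁺ l refl π⊆))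

T-not-any-≡ᵇ⇒All≢ : ∀ x xs → T (not (any (x ≡ᵇ_) xs)) → All (x ≢_) xs
T-not-any-≡ᵇ⇒All≢ x []       _ = []
T-not-any-≡ᵇ⇒All≢ x (y ∷ ys) h with x ≡ᵇ y in eq
... | true  = ⊥-elim h
... | false = (λ x≡y → subst T eq (≡⇒≡ᵇ x y x≡y)) ∷ T-not-any-≡ᵇ⇒All≢ x ys h

All≢⇒T-not-any-≡ᵇ : ∀ x xs → All (x ≢_) xs → T (not (any (x ≡ᵇ_) xs))
All≢⇒T-not-any-≡ᵇ x []       []          = _
All≢⇒T-not-any-≡ᵇ x (y ∷ ys) (x≢y ∷ x∉) with x ≡ᵇ y in eq
... | true  = x≢y (≡ᵇ⇒≡ x y (subst T (sym eq) _))
... | false = All≢⇒T-not-any-≡ᵇ x ys x∉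

distinctᵇ⇒Unique : ∀ xs → T (distinctᵇ xs) → Unique xs
distinctᵇ⇒Unique []       _ = []
distinctᵇ⇒Unique (x ∷ xs) h with x∉ , distinct ← Equivalence.to T-∧ h
  = T-not-any-≡ᵇ⇒All≢ x xs x∉ ∷ distinctᵇ⇒Unique xs distinct

Unique⇒distinctᵇ : Unique xs → T (distinctᵇ xs)
Unique⇒distinctᵇ []                     = _
Unique⇒distinctᵇ {xs = x ∷ xs} (x∉ ∷ u) =
  Equivalence.from T-∧ (All≢⇒T-not-any-≡ᵇ x xs x∉ , Unique⇒distinctᵇ u)

perms-unique : ∀ N → Unique (perms N)
perms-unique N = Unique.filter⁺ _ (seqs-unique N N)

∈-perms⁻ : ∀ {N π} → π ∈ perms N → π ↭ range N
∈-perms⁻ {N} {π} π∈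
  with π∈seqs , distinct ← ∈-filter⁻ (λ π → distinctᵇ π Bool.≟ true) π∈
  with len , π⊆ ← ∈-seqs⁻ N π∈seqs
  = unique-⊆⇒↭ (distinctᵇ⇒Unique π (Equivalence.from T-≡ distinct)) (All.lookup π⊆)
                (≤-reflexive (trans (length-range N) (sym len)))

∈-perms⁺ : ∀ {N π} → π ↭ range N → π ∈ perms N
∈-perms⁺ {N} π↭ = ∈-filter⁺ (λ π → distinctᵇ π Bool.≟ true)
  (∈-seqs⁺ N (trans (↭-length π↭) (length-range N)) (All.tabulate (∈-resp-↭ π↭)))
  (Equivalence.to T-≡ (Unique⇒distinctᵇ (Unique-resp-↭ (setoid ℕ) (↭⇒↭ₛ (↭-sym π↭)) (range-unique N))))

perm-length : ∀ {n σ} → σ ↭ range n → length σ ≡ n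
perm-length {n} σ↭ = trans (↭-length σ↭) (length-range n)

perm-positive : ∀ {n σ} → σ ↭ range n → All (0 ℕ.<_) σ
perm-positive {n} σ↭ = All-resp-↭ (↭-sym σ↭) (All.map⁺ (All.universal (λ _ → s≤s z≤n) (upTo n)))

insertMin : List ℕ → ℕ → List ℕ
insertMin σ p = insert p 1 (map suc σ)

insertions : ℕ → List (List ℕ)
insertions n = map (uncurry insertMin) (cartesianProduct (perms n) (upTo (suc n)))

1∉map-suc : ∀ {σ} → All (0 ℕ.<_) σ → 1 ∉ map suc σ
1∉map-suc (()  ∷ _)   (here refl)
1∉map-suc (_   ∷ σ⁺) (there 1∈) = 1∉map-suc σ⁺ 1∈

insertions-unique : ∀ n → Unique (insertions n)
insertions-unique n = map-unique injective (Unique.cartesianProduct⁺ (perms-unique n) (Unique.upTo⁺ (suc n)))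
  where
  position-bound : ∀ {σ p} → σ ∈ perms n → p ∈ upTo (suc n) → p ≤ length (map suc σ)
  position-bound {σ} σ∈ p∈ =
    subst (_ ≤_) (sym (trans (length-map suc σ) (perm-length (∈-perms⁻ {n} σ∈)))) (≤-pred (∈-upTo⁻ p∈))
  injective : ∀ {x y} → x ∈ cartesianProduct (perms n) (upTo (suc n)) →
              y ∈ cartesianProduct (perms n) (upTo (suc n)) →
              uncurry insertMin x ≡ uncurry insertMin y → x ≡ y
  injective {σ , p} {τ , q} x∈ y∈ eq
    with σ∈ , p∈ ← ∈-cartesianProduct⁻ (perms n) (upTo (suc n)) x∈
    with τ∈ , q∈ ← ∈-cartesianProduct⁻ (perms n) (upTo (suc n)) y∈
    with refl , sσ≡sτ ← insert-injective p q (map suc σ) (map suc τ)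
           (1∉map-suc (perm-positive (∈-perms⁻ {n} σ∈))) (1∉map-suc (perm-positive (∈-perms⁻ {n} τ∈)))
           (position-bound σ∈ p∈) (position-bound τ∈ q∈) eq
    with refl ← map-injective suc-injective sσ≡sτ
    = refl

∈-insertions⁻ : ∀ {n π} → π ∈ insertions n → π ↭ range (suc n)
∈-insertions⁻ {n} π∈
  with (σ , p) , σp∈ , refl ← ∈-map⁻ (uncurry insertMin) π∈
  with σ∈ , _ ← ∈-cartesianProduct⁻ (perms n) (upTo (suc n)) σp∈
  = begin
    insert p 1 (map suc σ)  ↭⟨ insert-↭ p 1 (map suc σ) ⟩
    1 ∷ map suc σ           ↭⟨ ↭-prep 1 (map⁺ suc (∈-perms⁻ {n} σ∈)) ⟩
    1 ∷ map suc (range n)   ≡⟨ range-suc n ⟨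
    range (suc n)           ∎
  where open PermutationReasoning

∈-insertions⁺ : ∀ {n π} → π ↭ range (suc n) → π ∈ insertions n
∈-insertions⁺ {n} {π} π↭
  with as , bs , refl ← ∈-∃++ (∈-resp-↭ (↭-sym π↭) (subst (1 ∈_) (sym (range-suc n)) (here refl)))
  with σ , as++bs≡ , range↭σ ← ↭-map-inv suc (↭-sym (drop-mid as [] (subst (π ↭_) (range-suc n) π↭)))
  = subst (_∈ insertions n) π≡
      (∈-map⁺ (uncurry insertMin) (∈-cartesianProduct⁺ (∈-perms⁺ {n} (↭-sym range↭σ)) p∈))
  where
  p∈ : length as ∈ upTo (suc n)
  p∈ = ∈-upTo⁺ (s≤s (begin
    length as                ≤⟨ m≤m+n (length as) (length bs) ⟩
    length as ℕ.+ length bs  ≡⟨ length-++ as ⟨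
    length (as ++ bs)        ≡⟨ cong length as++bs≡ ⟩
    length (map suc σ)       ≡⟨ trans (length-map suc σ) (perm-length (↭-sym range↭σ)) ⟩
    n                        ∎))
    where open ≤-Reasoning
  π≡ : insertMin σ (length as) ≡ as ++ 1 ∷ bs
  π≡ = trans (cong (insert (length as) 1) (sym as++bs≡)) (insert-++ 1 as bs)

perms-suc-↭ : ∀ n → perms (suc n) ↭ insertions n
perms-suc-↭ n = ∼bag⇒↭ (unique∧set⇒bag (perms-unique (suc n)) (insertions-unique n)
  (mk⇔ (∈-insertions⁺ ∘ ∈-perms⁻ {suc n}) (∈-perms⁺ {suc n} ∘ ∈-insertions⁻)))

select-map-suc : ∀ k m σ → select k (suc m) (map suc σ) ≡ Maybe.map suc (select k m σ)
select-map-suc k       m []      = refl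
select-map-suc zero    m (x ∷ σ) with m <ᵇ x
... | true  = refl
... | false = select-map-suc zero (m ⊔ x) σ
select-map-suc (suc k) m (x ∷ σ) = select-map-suc k (m ⊔ x) σ

select-after-1 : ∀ k m σ → select k (suc m ⊔ 1) (map suc σ) ≡ Maybe.map suc (select k m σ)
select-after-1 k m σ = trans (cong (λ m′ → select k (suc m′) (map suc σ)) (⊔-identityʳ m)) (select-map-suc k m σ)

select-insertMin-early : ∀ {k p} m σ → p ≤ k →
                         select (suc k) (suc m) (insertMin σ p) ≡ Maybe.map suc (select k m σ)
select-insertMin-early {k}     {zero}  m σ       _         = select-after-1 k m σ
select-insertMin-early {suc k} {suc p} m []      _         = refl
select-insertMin-early {suc k} {suc p} m (y ∷ σ) (s≤s p≤k) = select-insertMin-early (m ⊔ y) σ p≤k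

select-insertMin-late : ∀ {k p} m σ → k ≤ p →
                        select k (suc m) (insertMin σ p) ≡ Maybe.map suc (select k m σ)
select-insertMin-late {zero}  {zero}  m σ       _ = select-after-1 zero m σ
select-insertMin-late {zero}  {suc p} m []      _ = refl
select-insertMin-late {zero}  {suc p} m (y ∷ σ) _ with m <ᵇ y
... | true  = refl
... | false = select-insertMin-late {p = p} (m ⊔ y) σ z≤n
select-insertMin-late {suc k} {suc p} m []      _         = refl
select-insertMin-late {suc k} {suc p} m (y ∷ σ) (s≤s k≤p) = select-insertMin-late (m ⊔ y) σ k≤p

select₀-insertMin-early : ∀ {k p} σ → p ≤ k → select (suc k) 0 (insertMin σ p) ≡ Maybe.map suc (select k 0 σ)
select₀-insertMin-early {k}     {zero}  σ       _         = select-map-suc k 0 σ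
select₀-insertMin-early {suc k} {suc p} []      _         = refl
select₀-insertMin-early {suc k} {suc p} (y ∷ σ) (s≤s p≤k) = select-insertMin-early y σ p≤k

-- the initial maximum 0 is a sentinel below every entry, hence the positivity of σ
select₀-insertMin-late : ∀ {k p} σ → k ≤ suc p → suc p ≤ length σ → All (0 ℕ.<_) σ →
                         select k 0 (insertMin σ (suc p)) ≡ Maybe.map suc (select k 0 σ)
select₀-insertMin-late {zero}  (y ∷ σ) _         _ (s≤s _ ∷ _) = refl
select₀-insertMin-late {suc k} (y ∷ σ) (s≤s k≤p) _ _           = select-insertMin-late y σ k≤p

winnable-map-suc : ∀ {n k k′ π σ} → select k 0 π ≡ Maybe.map suc (select k′ 0 σ) →
                   winnableᵇ (suc n) k π ≡ winnableᵇ n k′ σ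
winnable-map-suc {n} {k} {k′} {π} {σ} eq with select k 0 π | select k′ 0 σ
winnable-map-suc refl | just _  | just _  = refl
winnable-map-suc refl | nothing | nothing = refl

select-short : ∀ k m xs → length xs ≤ k → select k m xs ≡ nothing
select-short k       m []       _         = refl
select-short (suc k) m (x ∷ xs) (s≤s l≤k) = select-short k (m ⊔ x) xs l≤k

below : ℕ → List ℕ → ℕ
below x xs = sum (map (λ y → if y <ᵇ x then 1 else 0) xs)

below-↭ : ∀ x → xs ↭ ys → below x xs ≡ below x ys
below-↭ x p = sum-↭ (map⁺ _ p)

below-map-suc : ∀ x σ → below (suc x) (map suc σ) ≡ below x σ
below-map-suc x []      = refl
below-map-suc x (y ∷ σ) = cong ((if y <ᵇ x then 1 else 0) ℕ.+_) (below-map-suc x σ)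

below-1-map-suc : ∀ σ → below 1 (map suc σ) ≡ 0
below-1-map-suc []      = refl
below-1-map-suc (y ∷ σ) = below-1-map-suc σ

inv-map-suc : ∀ σ → inv (map suc σ) ≡ inv σ
inv-map-suc []      = refl
inv-map-suc (y ∷ σ) = cong₂ ℕ._+_ (below-map-suc y σ) (inv-map-suc σ)

inv-insertMin : ∀ {p} σ → p ≤ length σ → All (0 ℕ.<_) σ → inv (insertMin σ p) ≡ p ℕ.+ inv σ
inv-insertMin {zero}  σ       _        _                = cong₂ ℕ._+_ (below-1-map-suc σ) (inv-map-suc σ)
inv-insertMin {suc p} (y ∷ σ) (s≤s p≤) (s≤s z≤n ∷ σ⁺) = begin
  below (suc y) (insertMin σ p) ℕ.+ inv (insertMin σ p)
    ≡⟨ cong₂ ℕ._+_ (below-↭ (suc y) (insert-↭ p 1 (map suc σ))) (inv-insertMin σ p≤ σ⁺) ⟩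
  suc (below (suc y) (map suc σ) ℕ.+ (p ℕ.+ inv σ))
    ≡⟨ cong (λ b → suc (b ℕ.+ (p ℕ.+ inv σ))) (below-map-suc y σ) ⟩
  suc (below y σ ℕ.+ (p ℕ.+ inv σ))
    ≡⟨ cong suc (x∙yz≈y∙xz (below y σ) p (inv σ)) ⟩
  suc (p ℕ.+ (below y σ ℕ.+ inv σ)) ∎
  where open ≡-Reasoning

suc[m+n]∸m≡suc[n] : ∀ m n → suc (m ℕ.+ n) ∸ m ≡ suc n
suc[m+n]∸m≡suc[n] m n = trans (cong (_∸ m) (sym (+-suc m n))) (m+n∸m≡n m (suc n))

/-*-reciprocal : ∀ p q → p / q ≡ p * (1ℚ / q)
/-*-reciprocal p q with q ℚ.≟ 0ℚ
... | yes _ = sym (ℚ.*-zeroʳ p)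
... | no  _ = cong (p *_) (sym (ℚ.*-identityˡ _))

/-inverseʳ : ∀ {q} → q ≢ 0ℚ → q * (1ℚ / q) ≡ 1ℚ
/-inverseʳ {q} q≢0 with q ℚ.≟ 0ℚ
... | yes q≡0 = contradiction q≡0 q≢0
... | no  q≢0 = trans (cong (q *_) (ℚ.*-identityˡ _)) (ℚ.*-inverseʳ q {{≢-nonZero q≢0}})

-- The inductive step of W-closed with the q-numbers abstracted; for m = j + d + 1: g = [j+1], a = [j],
-- c = [d+2], z = [m+1] = [j] + θ^j [d+2], F = [m]!, td = θ^d, tj = θ^j, Hm = H m, Hj = H j, ig = 1/g, iz = 1/z.
harmonic-step : ∀ θ td tj F a g c z Hm Hj ig iz → g * ig ≡ 1ℚ → z * iz ≡ 1ℚ → a + tj * c ≡ z →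
  g * (θ * td * F * (1ℚ + a * (Hm - Hj))) + θ * tj * c * (td * F * (1ℚ + g * (Hm - (Hj + ig))))
  ≡ θ * td * (z * F) * (1ℚ + g * (Hm + iz - (Hj + ig)))
harmonic-step θ td tj F a g c _ Hm Hj ig iz g·ig≡1 z·iz≡1 refl =
  trans (split θ td tj F a g c Hm Hj ig iz)
        (trans (cong₂ (λ u v → rhs + θ * td * F * (g * (1ℚ - u) - a * (1ℚ - v))) z·iz≡1 g·ig≡1)
               (drop-zero rhs (θ * td * F) g a))
  where
  rhs : ℚ
  rhs = θ * td * ((a + tj * c) * F) * (1ℚ + g * (Hm + iz - (Hj + ig)))
  -- with z = a + tj c the two sides differ by θ td F (g (1 − z iz) − a (1 − g ig))
  split : ∀ θ td tj F a g c Hm Hj ig iz →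
    g * (θ * td * F * (1ℚ + a * (Hm - Hj))) + θ * tj * c * (td * F * (1ℚ + g * (Hm - (Hj + ig))))
    ≡ θ * td * ((a + tj * c) * F) * (1ℚ + g * (Hm + iz - (Hj + ig)))
      + θ * td * F * (g * (1ℚ - (a + tj * c) * iz) - a * (1ℚ - g * ig))
  split = solve-∀ ℚ-ring
  drop-zero : ∀ x p g a → x + p * (g * (1ℚ - 1ℚ) - a * (1ℚ - 1ℚ)) ≡ x
  drop-zero = solve-∀ ℚ-ring

module _ (θ : ℚ) where

  weight : ℕ → ℕ → List ℕ → ℚ
  weight N k π = if winnableᵇ N k π then θ ^ inv π else 0ℚ

  W≡∑weight : ∀ N k → W θ N k ≡ ∑[ π ∈ perms N ] weight N k π
  W≡∑weight N k = ∑-filter (winnableᵇ N k) (perms N)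

  W-vanish : ∀ {n k} → n ≤ k → W θ n k ≡ 0ℚ
  W-vanish {n} {k} n≤k = cong (λ πs → sumℚ (map (λ π → θ ^ inv π) πs))
    (filter-none (λ π → winnableᵇ n k π Bool.≟ true) (All.tabulate loses))
    where
    loses : ∀ {π} → π ∈ perms n → winnableᵇ n k π ≢ true
    loses {π} π∈ rewrite select-short k 0 π (subst (_≤ k) (sym (perm-length (∈-perms⁻ {n} π∈))) n≤k) = λ ()

  ^-+ : ∀ m n → θ ^ (m ℕ.+ n) ≡ θ ^ m * θ ^ n
  ^-+ zero    n = sym (ℚ.*-identityˡ _)
  ^-+ (suc m) n = trans (cong (θ *_) (^-+ m n)) (sym (ℚ.*-assoc θ _ _))

  ∑-^-+ : ∀ m n → ∑[ i ∈ upTo n ] θ ^ (m ℕ.+ i) ≡ θ ^ m * [ n ] θ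
  ∑-^-+ m n = trans (∑-cong (upTo n) (λ {i} _ → ^-+ m i)) (∑-*ˡ (θ ^ m) (upTo n))

  [+] : ∀ m n → [ m ℕ.+ n ] θ ≡ [ m ] θ + θ ^ m * [ n ] θ
  [+] m n = trans (∑-upTo-+ (θ ^_) m n) (cong ([ m ] θ +_) (∑-^-+ m n))

  weight-insertMin : ∀ {n k k′} σ p → select k 0 (insertMin σ p) ≡ Maybe.map suc (select k′ 0 σ) →
                     p ≤ length σ → All (0 ℕ.<_) σ →
                     weight (suc n) k (insertMin σ p) ≡ θ ^ p * weight n k′ σ
  weight-insertMin {n} {k} {k′} σ p sel p≤ σ⁺
    rewrite winnable-map-suc {n} {k} {k′} {insertMin σ p} {σ} sel | inv-insertMin σ p≤ σ⁺
    with winnableᵇ n k′ σ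
  ... | true  = ^-+ p (inv σ)
  ... | false = sym (ℚ.*-zeroʳ (θ ^ p))

  W-suc : ∀ n k → W θ (suc n) k ≡ ∑[ σ ∈ perms n ] ∑[ p ∈ upTo (suc n) ] weight (suc n) k (insertMin σ p)
  W-suc n k = begin
    W θ (suc n) k
      ≡⟨ W≡∑weight (suc n) k ⟩
    ∑ (perms (suc n)) (weight (suc n) k)
      ≡⟨ ∑-↭ (perms-suc-↭ n) ⟩
    ∑ (insertions n) (weight (suc n) k)
      ≡⟨ ∑-map (uncurry insertMin) (cartesianProduct (perms n) (upTo (suc n))) ⟩
    ∑ (cartesianProduct (perms n) (upTo (suc n))) (weight (suc n) k ∘ uncurry insertMin)
      ≡⟨ ∑-cartesianProduct (perms n) _ _ ⟩
    ∑[ σ ∈ perms n ] ∑[ p ∈ upTo (suc n) ] weight (suc n) k (insertMin σ p) ∎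
    where open ≡-Reasoning

  ∑-geometric : ∀ m n c → ∑[ i ∈ upTo n ] (θ ^ (m ℕ.+ i) * c) ≡ θ ^ m * [ n ] θ * c
  ∑-geometric m n c = trans (∑-*ʳ c (upTo n)) (cong (_* c) (∑-^-+ m n))

  W-rec : ∀ {n} j d → j ℕ.+ d ≡ n →
          W θ (suc n) (suc j) ≡ [ suc j ] θ * W θ n j + θ ^ suc j * [ d ] θ * W θ n (suc j)
  W-rec {n} j d refl = begin
    W θ (suc n) (suc j)
      ≡⟨ W-suc n (suc j) ⟩
    ∑[ σ ∈ perms n ] ∑[ p ∈ upTo (suc n) ] weight (suc n) (suc j) (insertMin σ p)
      ≡⟨ ∑-cong (perms n) (λ σ∈ → insertion-sum (∈-perms⁻ {n} σ∈)) ⟩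
    ∑[ σ ∈ perms n ] ([ suc j ] θ * weight n j σ + θ ^ suc j * [ d ] θ * weight n (suc j) σ)
      ≡⟨ ∑-+ (perms n) ⟩
    ∑[ σ ∈ perms n ] ([ suc j ] θ * weight n j σ) + ∑[ σ ∈ perms n ] (θ ^ suc j * [ d ] θ * weight n (suc j) σ)
      ≡⟨ cong₂ _+_ (∑-*ˡ ([ suc j ] θ) (perms n)) (∑-*ˡ (θ ^ suc j * [ d ] θ) (perms n)) ⟩
    [ suc j ] θ * ∑ (perms n) (weight n j) + θ ^ suc j * [ d ] θ * ∑ (perms n) (weight n (suc j))
      ≡⟨ cong₂ (λ x y → [ suc j ] θ * x + θ ^ suc j * [ d ] θ * y) (W≡∑weight n j) (W≡∑weight n (suc j)) ⟨
    [ suc j ] θ * W θ n j + θ ^ suc j * [ d ] θ * W θ n (suc j) ∎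
    where
    open ≡-Reasoning
    insertion-sum : ∀ {σ} → σ ↭ range n →
      ∑[ p ∈ upTo (suc n) ] weight (suc n) (suc j) (insertMin σ p) ≡
      [ suc j ] θ * weight n j σ + θ ^ suc j * [ d ] θ * weight n (suc j) σ
    insertion-sum {σ} σ↭ = begin
      ∑[ p ∈ upTo (suc j ℕ.+ d) ] weight (suc n) (suc j) (insertMin σ p)
        ≡⟨ ∑-upTo-+ (λ p → weight (suc n) (suc j) (insertMin σ p)) (suc j) d ⟩
      ∑[ p ∈ upTo (suc j) ] weight (suc n) (suc j) (insertMin σ p) +
      ∑[ i ∈ upTo d ] weight (suc n) (suc j) (insertMin σ (suc j ℕ.+ i))
        ≡⟨ cong₂ _+_ (∑-cong (upTo (suc j)) early) (∑-cong (upTo d) late) ⟩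
      ∑[ p ∈ upTo (suc j) ] (θ ^ p * weight n j σ) + ∑[ i ∈ upTo d ] (θ ^ (suc j ℕ.+ i) * weight n (suc j) σ)
        ≡⟨ cong₂ _+_ (∑-*ʳ {f = θ ^_} (weight n j σ) (upTo (suc j)))
                     (∑-geometric (suc j) d (weight n (suc j) σ)) ⟩
      [ suc j ] θ * weight n j σ + θ ^ suc j * [ d ] θ * weight n (suc j) σ ∎
      where
      len≡ : n ≡ length σ
      len≡ = sym (perm-length σ↭)
      early : ∀ {p} → p ∈ upTo (suc j) → weight (suc n) (suc j) (insertMin σ p) ≡ θ ^ p * weight n j σ
      early {p} p∈ = weight-insertMin σ p (select₀-insertMin-early σ p≤j)
                       (subst (_ ≤_) len≡ (≤-trans p≤j (m≤m+n j d))) (perm-positive σ↭)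
        where
        p≤j : p ≤ j
        p≤j = ≤-pred (∈-upTo⁻ p∈)
      late : ∀ {i} → i ∈ upTo d →
             weight (suc n) (suc j) (insertMin σ (suc j ℕ.+ i)) ≡ θ ^ (suc j ℕ.+ i) * weight n (suc j) σ
      late {i} i∈ = weight-insertMin σ (suc j ℕ.+ i)
                      (select₀-insertMin-late σ (s≤s (m≤m+n j i)) p≤len (perm-positive σ↭))
                      p≤len (perm-positive σ↭)
        where
        p≤len : suc j ℕ.+ i ≤ length σ
        p≤len = subst₂ _≤_ (+-suc j i) len≡ (+-monoʳ-≤ j (∈-upTo⁻ i∈))

  W-rec₀ : ∀ n → W θ (suc (suc n)) 0 ≡ θ ^ 1 * [ suc n ] θ * W θ (suc n) 0
  W-rec₀ n = begin
    W θ (suc (suc n)) 0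
      ≡⟨ W-suc (suc n) 0 ⟩
    ∑[ σ ∈ perms (suc n) ] ∑[ p ∈ upTo (suc (suc n)) ] weight (suc (suc n)) 0 (insertMin σ p)
      ≡⟨ ∑-cong (perms (suc n)) (λ σ∈ → insertion-sum (∈-perms⁻ {suc n} σ∈)) ⟩
    ∑[ σ ∈ perms (suc n) ] (θ ^ 1 * [ suc n ] θ * weight (suc n) 0 σ)
      ≡⟨ ∑-*ˡ (θ ^ 1 * [ suc n ] θ) (perms (suc n)) ⟩
    θ ^ 1 * [ suc n ] θ * ∑ (perms (suc n)) (weight (suc n) 0)
      ≡⟨ cong (θ ^ 1 * [ suc n ] θ *_) (W≡∑weight (suc n) 0) ⟨
    θ ^ 1 * [ suc n ] θ * W θ (suc n) 0 ∎
    where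
    open ≡-Reasoning
    insertion-sum : ∀ {σ} → σ ↭ range (suc n) →
      ∑[ p ∈ upTo (suc (suc n)) ] weight (suc (suc n)) 0 (insertMin σ p) ≡ θ ^ 1 * [ suc n ] θ * weight (suc n) 0 σ
    insertion-sum {σ} σ↭ = begin
      ∑[ p ∈ upTo (1 ℕ.+ suc n) ] weight (suc (suc n)) 0 (insertMin σ p)
        ≡⟨ ∑-upTo-+ (λ p → weight (suc (suc n)) 0 (insertMin σ p)) 1 (suc n) ⟩
      -- at position 0 the strategy accepts the inserted 1, which loses
      0ℚ + ∑[ i ∈ upTo (suc n) ] weight (suc (suc n)) 0 (insertMin σ (suc i))
        ≡⟨ ℚ.+-identityˡ _ ⟩
      ∑[ i ∈ upTo (suc n) ] weight (suc (suc n)) 0 (insertMin σ (suc i))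
        ≡⟨ ∑-cong (upTo (suc n)) late ⟩
      ∑[ i ∈ upTo (suc n) ] (θ ^ (1 ℕ.+ i) * weight (suc n) 0 σ)
        ≡⟨ ∑-geometric 1 (suc n) (weight (suc n) 0 σ) ⟩
      θ ^ 1 * [ suc n ] θ * weight (suc n) 0 σ ∎
      where
      late : ∀ {i} → i ∈ upTo (suc n) →
             weight (suc (suc n)) 0 (insertMin σ (suc i)) ≡ θ ^ (suc i) * weight (suc n) 0 σ
      late {i} i∈ = weight-insertMin σ (suc i) (select₀-insertMin-late σ z≤n p≤len (perm-positive σ↭))
                      p≤len (perm-positive σ↭)
        where
        p≤len : suc i ≤ length σ
        p≤len = subst (_ ≤_) (sym (perm-length σ↭)) (∈-upTo⁻ i∈)

  H : ℕ → ℚ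
  H zero    = 0ℚ
  H (suc m) = H m + 1ℚ / ([ suc m ] θ)

  ∑-reciprocals : ∀ k d → ∑[ i ∈ upTo d ] (1ℚ / ([ suc (k ℕ.+ i) ] θ)) ≡ H (k ℕ.+ d) - H k
  ∑-reciprocals k zero = begin
    0ℚ                 ≡⟨ ℚ.+-inverseʳ (H k) ⟨
    H k - H k          ≡⟨ cong (λ i → H i - H k) (+-identityʳ k) ⟨
    H (k ℕ.+ 0) - H k  ∎
    where open ≡-Reasoning
  ∑-reciprocals k (suc d) = begin
    ∑[ i ∈ upTo (suc d) ] (1ℚ / ([ suc (k ℕ.+ i) ] θ))
      ≡⟨ ∑-upTo-suc (λ i → 1ℚ / ([ suc (k ℕ.+ i) ] θ)) d ⟩
    ∑[ i ∈ upTo d ] (1ℚ / ([ suc (k ℕ.+ i) ] θ)) + 1ℚ / ([ suc (k ℕ.+ d) ] θ)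
      ≡⟨ cong (_+ 1ℚ / ([ suc (k ℕ.+ d) ] θ)) (∑-reciprocals k d) ⟩
    H (k ℕ.+ d) - H k + 1ℚ / ([ suc (k ℕ.+ d) ] θ)
      ≡⟨ -+-comm (H (k ℕ.+ d)) (H k) _ ⟩
    H (suc (k ℕ.+ d)) - H k
      ≡⟨ cong (λ i → H i - H k) (+-suc k d) ⟨
    H (k ℕ.+ suc d) - H k ∎
    where
    open ≡-Reasoning
    -+-comm : ∀ a b c → a - b + c ≡ a + c - b
    -+-comm = solve-∀ ℚ-ring

  rhsSum-harmonic : ∀ k d → [ k ] θ ≢ 0ℚ → rhsSum θ (suc (k ℕ.+ d)) k ≡ 1ℚ + [ k ] θ * (H (k ℕ.+ d) - H k)
  rhsSum-harmonic k d [k]≢0 = begin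
    rhsSum θ (suc (k ℕ.+ d)) k
      ≡⟨ cong (λ n → ∑ (map (k ℕ.+_) (upTo n)) (λ i → ([ k ] θ) / ([ i ] θ))) (suc[m+n]∸m≡suc[n] k d) ⟩
    ∑ (map (k ℕ.+_) (upTo (1 ℕ.+ d))) (λ i → ([ k ] θ) / ([ i ] θ))
      ≡⟨ ∑-map {f = λ i → ([ k ] θ) / ([ i ] θ)} (k ℕ.+_) (upTo (1 ℕ.+ d)) ⟩
    ∑[ i ∈ upTo (1 ℕ.+ d) ] (([ k ] θ) / ([ k ℕ.+ i ] θ))
      ≡⟨ ∑-upTo-+ (λ i → ([ k ] θ) / ([ k ℕ.+ i ] θ)) 1 d ⟩
    ([ k ] θ) / ([ k ℕ.+ 0 ] θ) + 0ℚ + ∑[ i ∈ upTo d ] (([ k ] θ) / ([ k ℕ.+ suc i ] θ))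
      ≡⟨ cong₂ _+_ first-term other-terms ⟩
    1ℚ + [ k ] θ * (H (k ℕ.+ d) - H k) ∎
    where
    open ≡-Reasoning
    first-term : ([ k ] θ) / ([ k ℕ.+ 0 ] θ) + 0ℚ ≡ 1ℚ
    first-term = begin
      ([ k ] θ) / ([ k ℕ.+ 0 ] θ) + 0ℚ  ≡⟨ ℚ.+-identityʳ _ ⟩
      ([ k ] θ) / ([ k ℕ.+ 0 ] θ)       ≡⟨ cong (λ i → ([ k ] θ) / ([ i ] θ)) (+-identityʳ k) ⟩
      ([ k ] θ) / ([ k ] θ)             ≡⟨ /-*-reciprocal ([ k ] θ) ([ k ] θ) ⟩
      [ k ] θ * (1ℚ / ([ k ] θ))        ≡⟨ /-inverseʳ [k]≢0 ⟩
      1ℚ                                ∎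
    other-terms : ∑[ i ∈ upTo d ] (([ k ] θ) / ([ k ℕ.+ suc i ] θ)) ≡ [ k ] θ * (H (k ℕ.+ d) - H k)
    other-terms = begin
      ∑[ i ∈ upTo d ] (([ k ] θ) / ([ k ℕ.+ suc i ] θ))
        ≡⟨ ∑-cong (upTo d) (λ {i} _ → trans (cong (λ n → ([ k ] θ) / ([ n ] θ)) (+-suc k i))
                                             (/-*-reciprocal ([ k ] θ) ([ suc (k ℕ.+ i) ] θ))) ⟩
      ∑[ i ∈ upTo d ] ([ k ] θ * (1ℚ / ([ suc (k ℕ.+ i) ] θ)))
        ≡⟨ ∑-*ˡ ([ k ] θ) (upTo d) ⟩
      [ k ] θ * ∑[ i ∈ upTo d ] (1ℚ / ([ suc (k ℕ.+ i) ] θ))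
        ≡⟨ cong ([ k ] θ *_) (∑-reciprocals k d) ⟩
      [ k ] θ * (H (k ℕ.+ d) - H k) ∎

  W-zero : ∀ n → W θ (suc n) 0 ≡ θ ^ n * [ n ]! θ
  W-zero zero    = refl
  W-zero (suc n) = begin
    W θ (suc (suc n)) 0                          ≡⟨ W-rec₀ n ⟩
    θ ^ 1 * [ suc n ] θ * W θ (suc n) 0          ≡⟨ cong (θ ^ 1 * [ suc n ] θ *_) (W-zero n) ⟩
    θ ^ 1 * [ suc n ] θ * (θ ^ n * [ n ]! θ)     ≡⟨ reassociate θ ([ suc n ] θ) (θ ^ n) ([ n ]! θ) ⟩
    θ ^ suc n * [ suc n ]! θ                     ∎
    where
    open ≡-Reasoning
    reassociate : ∀ a b c d → a * 1ℚ * b * (c * d) ≡ a * c * (b * d)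
    reassociate = solve-∀ ℚ-ring

  W-closed : (∀ m → [ suc m ] θ ≢ 0ℚ) → ∀ k d {n} → k ℕ.+ d ≡ n →
             W θ (suc n) k ≡ θ ^ d * [ n ]! θ * (1ℚ + [ k ] θ * (H n - H k))
  W-closed _ zero d refl = trans (W-zero d) (no-correction (θ ^ d * [ d ]! θ) (H d))
    where
    no-correction : ∀ x h → x ≡ x * (1ℚ + 0ℚ * (h - 0ℚ))
    no-correction = solve-∀ ℚ-ring
  W-closed nz (suc j) zero refl rewrite +-identityʳ j = begin
    W θ (suc (suc j)) (suc j)
      ≡⟨ W-rec j 1 (+-comm j 1) ⟩
    [ suc j ] θ * W θ (suc j) j + θ ^ suc j * [ 1 ] θ * W θ (suc j) (suc j)
      ≡⟨ cong₂ (λ x y → [ suc j ] θ * x + θ ^ suc j * [ 1 ] θ * y)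
               (W-closed nz j 0 (+-identityʳ j)) (W-vanish {suc j} ≤-refl) ⟩
    [ suc j ] θ * (1ℚ * [ j ]! θ * (1ℚ + [ j ] θ * (H j - H j))) + θ ^ suc j * [ 1 ] θ * 0ℚ
      ≡⟨ no-correction ([ suc j ] θ) ([ j ]! θ) ([ j ] θ) (H j) (H (suc j)) (θ ^ suc j * [ 1 ] θ) ⟩
    1ℚ * [ suc j ]! θ * (1ℚ + [ suc j ] θ * (H (suc j) - H (suc j))) ∎
    where
    open ≡-Reasoning
    no-correction : ∀ g F a h h′ c →
                    g * (1ℚ * F * (1ℚ + a * (h - h))) + c * 0ℚ ≡ 1ℚ * (g * F) * (1ℚ + g * (h′ - h′))
    no-correction = solve-∀ ℚ-ring
  W-closed nz (suc j) (suc d) refl = begin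
    W θ (suc (suc (j ℕ.+ suc d))) (suc j)
      ≡⟨ W-rec j (suc (suc d)) (+-suc j (suc d)) ⟩
    [ suc j ] θ * W θ (suc m) j + θ ^ suc j * [ suc (suc d) ] θ * W θ (suc m) (suc j)
      ≡⟨ cong₂ (λ x y → [ suc j ] θ * x + θ ^ suc j * [ suc (suc d) ] θ * y)
               (W-closed nz j (suc d) refl) (W-closed nz (suc j) d (sym (+-suc j d))) ⟩
    [ suc j ] θ * (θ ^ suc d * [ m ]! θ * (1ℚ + [ j ] θ * (H m - H j))) +
    θ ^ suc j * [ suc (suc d) ] θ * (θ ^ d * [ m ]! θ * (1ℚ + [ suc j ] θ * (H m - H (suc j))))
      ≡⟨ harmonic-step θ (θ ^ d) (θ ^ j) ([ m ]! θ) ([ j ] θ) ([ suc j ] θ) ([ suc (suc d) ] θ) ([ suc m ] θ)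
                       (H m) (H j) (1ℚ / ([ suc j ] θ)) (1ℚ / ([ suc m ] θ))
                       (/-inverseʳ (nz j)) (/-inverseʳ (nz m)) (sym [suc-m]) ⟩
    θ ^ suc d * [ suc m ]! θ * (1ℚ + [ suc j ] θ * (H (suc m) - H (suc j))) ∎
    where
    open ≡-Reasoning
    m : ℕ
    m = j ℕ.+ suc d
    [suc-m] : [ suc m ] θ ≡ [ j ] θ + θ ^ j * [ suc (suc d) ] θ
    [suc-m] = trans (cong (λ i → [ i ] θ) (sym (+-suc j (suc d)))) ([+] j (suc (suc d)))

  [suc] : ∀ m → [ suc m ] θ ≡ 1ℚ + θ * [ m ] θ
  [suc] m = trans ([+] 1 m) (cong (λ t → 1ℚ + t * [ m ] θ) (ℚ.*-identityʳ θ))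

  module _ (0≤θ : 0ℚ ℚ.≤ θ) where

    θ*-nonNeg : ∀ {q} → 0ℚ ℚ.≤ q → 0ℚ ℚ.≤ θ * q
    θ*-nonNeg {q} 0≤q = subst (ℚ._≤ θ * q) (ℚ.*-zeroʳ θ) (ℚ.*-monoˡ-≤-nonNeg θ {{ℚ.nonNegative 0≤θ}} 0≤q)

    []-nonNeg : ∀ m → 0ℚ ℚ.≤ [ m ] θ
    [suc]-positive : ∀ m → 0ℚ ℚ.< [ suc m ] θ

    []-nonNeg zero    = ℚ.≤-refl
    []-nonNeg (suc m) = ℚ.<⇒≤ ([suc]-positive m)

    [suc]-positive m =
      subst (0ℚ ℚ.<_) (sym ([suc] m)) (ℚ.+-mono-<-≤ (ℚ.positive⁻¹ 1ℚ) (θ*-nonNeg ([]-nonNeg m)))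

    [suc]≢0 : ∀ m → [ suc m ] θ ≢ 0ℚ
    [suc]≢0 m = ℚ.<⇒≢ ([suc]-positive m) ∘ sym

    W-via-rhsSum : ∀ n k → 1 ≤ k → k ≤ n →
                   W θ (suc n) k ≡ θ ^ (suc n ∸ k ∸ 1) * [ n ]! θ * rhsSum θ (suc n) k
    W-via-rhsSum n k@(suc j) _ k≤n with d , refl ← m≤n⇒∃[o]m+o≡n k≤n = begin
      W θ (suc (k ℕ.+ d)) k
        ≡⟨ W-closed [suc]≢0 k d refl ⟩
      θ ^ d * [ k ℕ.+ d ]! θ * (1ℚ + [ k ] θ * (H (k ℕ.+ d) - H k))
        ≡⟨ cong₂ (λ e s → θ ^ e * [ k ℕ.+ d ]! θ * s) (cong (_∸ 1) (suc[m+n]∸m≡suc[n] k d))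
                 (rhsSum-harmonic k d ([suc]≢0 j)) ⟨
      θ ^ (suc (k ℕ.+ d) ∸ k ∸ 1) * [ k ℕ.+ d ]! θ * rhsSum θ (suc (k ℕ.+ d)) k ∎
      where open ≡-Reasoning

corollary6p4 : (θ : ℚ) → 0ℚ < θ → (N : ℕ) → 1 ≤ N →
    ((k : ℕ) → 1 ≤ k → k ≤ N ∸ 1 →
      W θ N k ≡ ((θ ^ (N ∸ k ∸ 1)) * ([ N ∸ 1 ]! θ)) * rhsSum θ N k)
    × (W θ N 0 ≡ (θ ^ (N ∸ 1)) * ([ N ∸ 1 ]! θ))
corollary6p4 θ 0<θ (suc n) _ = W-via-rhsSum θ (ℚ.<⇒≤ 0<θ) n , W-zero θ n
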